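{- Let $D$ be a southwest diagram and $i\geq1$. Then for $S,T\in\mathrm{KD}(D)$, we have $\mathfrak{e}_i(T)=S$ if and only if $\mathfrak{f}_i(S)=T$.
   Context: A diagram is a finite set of cells $(c,r)$, $c,r$ positive integers ($c$ column, $r$ row, rows numbered from the bottom). A Kohnert move selects the rightmost cell of some row and moves it down within its column to the highest unoccupied position below it (row $\geq1$), if one exists, jumping over occupied positions. $\mathrm{KD}(D)$ is the set of diagrams obtained from $D$ by finite (possibly empty) sequences of Kohnert moves. $D$ is southwest if $(c_1,r_2),(c_2,r_1)\in D$ with $r_1<r_2$, $c_1<c_2$ implies $(c_1,r_1)\in D$. For $i\geq1$, the $i$-pairing of cells of $T$ in rows $i,i+1$ first pairs cells of rows $i$ and $i+1$ lying in the same column, then iteratively pairs an unpaired cell in row $i$ with an unpaired cell in row $i+1$ strictly to its right whenever all cells of rows $i,i+1$ in the columns strictly between them are already paired. Raising operator: $\mathfrak{e}_i(T)=0$ if row $i+1$ has no unpaired cell; otherwise $\mathfrak{e}_i(T)$ moves the rightmost unpaired cell of row $i+1$ down to row $i$ in its column. Lowering operator (relative to $D$), for $T\in\mathrm{KD}(D)$: if $T$ has an unpaired cell in row $i$, let $T'$ be obtained by moving the leftmost unpaired cell of row $i$ up to row $i+1$ in its column; if $T$ has no unpaired cell in row $i$ or $T'\notin\mathrm{KD}(D)$, set $\mathfrak{f}_i(T)=0$, otherwise $\mathfrak{f}_i(T)=T'$. -}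

module Defs where

open import Data.Nat using (ℕ; zero; suc; _≤_; _<_; _⊔_)
open import Data.Nat.Properties using (_≟_)
open import Data.Product using (_×_; _,_; proj₁; proj₂; Σ; Σ-syntax)
open import Data.Product.Properties using (≡-dec)
open import Data.List using (List; []; _∷_; filter; foldr; foldl; map; upTo; last)
open import Data.List.Relation.Unary.All using (All)
open import Data.Maybe using (Maybe; just; nothing)
open import Relation.Nullary using (¬_; yes; no)
open import Relation.Nullary.Decidable using (¬?)
open import Relation.Binary using (DecidableEquality)
open import Relation.Binary.PropositionalEquality using (_≡_)
open import Function.Bundles using (_⇔_)

-- A cell (c , r): c = column, r = row (rows numbered from the bottom).
Cell : Set
Cell = ℕ × ℕ

_≟c_ : DecidableEquality Cell
_≟c_ = ≡-dec _≟_ _≟_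

open import Data.List.Membership.DecPropositional _≟c_ public
  using (_∈_; _∉_; _∈?_)

-- A diagram is a finite set of cells, represented by a list of cells;
-- two lists denote the same diagram iff they have the same members.
Diagram : Set
Diagram = List Cell

_≈_ : Diagram → Diagram → Set
A ≈ B = (x : Cell) → (x ∈ A ⇔ x ∈ B)

ValidDiagram : Diagram → Set
ValidDiagram D = All (λ x → (1 ≤ proj₁ x) × (1 ≤ proj₂ x)) D

Southwest : Diagram → Set
Southwest D = (c₁ c₂ r₁ r₂ : ℕ) → (c₁ , r₂) ∈ D → (c₂ , r₁) ∈ D →
              r₁ < r₂ → c₁ < c₂ → (c₁ , r₁) ∈ D

move : Cell → Cell → Diagram → Diagram
move from to A = to ∷ filter (λ x → ¬? (x ≟c from)) A

-- A Kohnert move from A to B: the rightmost cell (c , r) of row r moves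
-- down in column c to the highest unoccupied position r' (1 ≤ r' < r)
-- below it, jumping over the occupied positions in between.
KohnertMove : Diagram → Diagram → Set
KohnertMove A B =
  Σ[ c ∈ ℕ ] Σ[ r ∈ ℕ ] Σ[ r' ∈ ℕ ]
    ( (c , r) ∈ A
    × ((c' : ℕ) → c < c' → (c' , r) ∉ A)
    × 1 ≤ r' × r' < r
    × (c , r') ∉ A
    × ((r'' : ℕ) → r' < r'' → r'' < r → (c , r'') ∈ A)
    × B ≈ move (c , r) (c , r') A )

data KD (D : Diagram) : Diagram → Set where
  kd-base : {A : Diagram} → A ≈ D → KD D A
  kd-step : {A B : Diagram} → KD D A → KohnertMove A B → KD D B

-- i-pairing of rows i and i+1, computed by scanning columns left to right.
-- State: (unpaired row-i columns, most recent first ;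
--         unpaired row-(i+1) columns, most recent first).
-- A cell of row i+1 pairs with the nearest preceding unpaired cell of row i
-- (all cells strictly between being paired); same-column cells pair first.
PairState : Set
PairState = List ℕ × List ℕ

pairStep : ℕ → Diagram → PairState → ℕ → PairState
pairStep i T (st , up) c with (c , i) ∈? T | (c , suc i) ∈? T
... | yes _ | yes _ = st , up
... | yes _ | no _  = c ∷ st , up
... | no _  | no _  = st , up
... | no _  | yes _ with st
...   | []       = [] , c ∷ up
...   | (_ ∷ st') = st' , up

maxCol : Diagram → ℕ
maxCol T = foldr _⊔_ 0 (map proj₁ T)

pairing : ℕ → Diagram → PairState
pairing i T = foldl (pairStep i T) ([] , []) (upTo (suc (maxCol T)))

unpairedLower : ℕ → Diagram → List ℕ
unpairedLower i T = proj₁ (pairing i T)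

unpairedUpper : ℕ → Diagram → List ℕ
unpairedUpper i T = proj₂ (pairing i T)

-- Raising operator e_i (nothing = 0): move the rightmost unpaired
-- cell of row i+1 down to row i.
raise : ℕ → Diagram → Maybe Diagram
raise i T with unpairedUpper i T
... | []      = nothing
... | (c ∷ _) = just (move (c , suc i) (c , i) T)

lowerCandidate : ℕ → Diagram → Maybe Diagram
lowerCandidate i T with last (unpairedLower i T)
... | nothing = nothing
... | just c  = just (move (c , i) (c , suc i) T)

RaiseEq : ℕ → Diagram → Diagram → Set
RaiseEq i T S = Σ[ S' ∈ Diagram ] (raise i T ≡ just S' × S' ≈ S)

-- "f_i(S) = T" for the lowering operator relative to D:
-- f_i(S) = T' when the candidate T' exists and T' ∈ KD(D), else 0.
LowerEq : Diagram → ℕ → Diagram → Diagram → Set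
LowerEq D i S T =
  Σ[ T' ∈ Diagram ] (lowerCandidate i S ≡ just T' × KD D T' × T' ≈ T)

-- The i-pairing is a left-to-right scan over the columns which keeps a stack of
-- unpaired row-i columns (newest first) and a list of unpaired row-(i+1) columns
-- (newest = rightmost first).  The heart of the proof compares the scans of
-- two occupancy patterns that differ only in one column c (module Swap):
--   * if c is the rightmost unpaired row-(i+1) column and its cell is moved
--     down, c sits at the bottom of the stack from then on, so it becomes the
--     leftmost unpaired row-i column;
--   * dually, if c is the leftmost unpaired row-i column and its cell is moved
--     up, c becomes the rightmost unpaired row-(i+1) column.  Since moving a
-- cell down and back up restores the diagram, e_i and the lowering candidate are
-- mutually inverse; membership of f_i(S) = T in KD(D) is the hypothesis T ∈ KD(D).

module Submission where

open import Defs
open import Data.Nat using (ℕ; _≤_)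
open import Function.Bundles using (_⇔_)

open import Data.Bool using (Bool; true; false)
open import Data.Nat using (zero; suc; _<_; _⊔_; s≤s; z≤n)
open import Data.Nat.Properties
  using (n<1+n; m<n⇒m<1+n; m≤n⇒m<n∨m≡n; <⇒≢; <-irrefl; <-≤-trans; ≤-trans;
         m≤m⊔n; m≤n⊔m; 1+n≢n)
open import Data.Product using (_×_; _,_; proj₁; proj₂; Σ-syntax)
open import Data.Sum using (_⊎_; inj₁; inj₂)
open import Data.List using (List; []; _∷_; _∷ʳ_; foldl; upTo; last)
open import Data.List.Properties using (foldl-∷ʳ; upTo-∷ʳ; ∷-injective)
open import Data.List.Relation.Unary.All as All using (All; []; _∷_)
open import Data.List.Relation.Unary.Any using (here; there)
open import Data.List.Membership.Propositional using () renaming (_∈_ to _∈ₗ_; _∉_ to _∉ₗ_)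
open import Data.List.Membership.Propositional.Properties using (∈-++⁺ʳ; ∈-filter⁺; ∈-filter⁻)
open import Data.Maybe using (just)
open import Data.Maybe.Properties using (just-injective)
open import Relation.Nullary using (¬_; Dec; yes; no; does; contradiction)
open import Relation.Nullary.Decidable using (¬?; dec-true; dec-false; does-⇔)
open import Relation.Binary.PropositionalEquality
  using (_≡_; _≢_; refl; sym; trans; cong; cong₂; subst; module ≡-Reasoning)
open import Relation.Binary.Structures using (IsEquivalence)
open import Function.Bundles using (mk⇔; Equivalence)
open import Function.Properties.Equivalence using (⇔-isEquivalence)
import Level

∈-∷ʳ : ∀ (b : List ℕ) c → c ∈ₗ b ∷ʳ c
∈-∷ʳ b c = ∈-++⁺ʳ b (here refl)

last-∷ʳ : ∀ (b : List ℕ) c → last (b ∷ʳ c) ≡ just c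
last-∷ʳ []          c = refl
last-∷ʳ (x ∷ [])    c = refl
last-∷ʳ (x ∷ y ∷ b) c = last-∷ʳ (y ∷ b) c

last-just : ∀ (l : List ℕ) {c} → last l ≡ just c → Σ[ b ∈ List ℕ ] (l ≡ b ∷ʳ c)
last-just (x ∷ [])    refl = [] , refl
last-just (x ∷ y ∷ l) e with last-just (y ∷ l) e
... | b , l≡ = x ∷ b , cong (x ∷_) l≡

-- Occupancy of a column in rows i and i+1: (row i occupied , row i+1 occupied).
Occupancy : Set
Occupancy = Bool × Bool

occ : ℕ → Diagram → ℕ → Occupancy
occ i T c = does ((c , i) ∈? T) , does ((c , suc i) ∈? T)

step : Occupancy → PairState → ℕ → PairState
step (true  , true ) s            c = s
step (true  , false) (l , u)      c = c ∷ l , u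
step (false , false) s            c = s
step (false , true ) ([] , u)     c = [] , c ∷ u
step (false , true ) (_ ∷ l , u)  c = l , u

pairStep-step : ∀ i T s c → pairStep i T s c ≡ step (occ i T c) s c
pairStep-step i T (l , u) c with (c , i) ∈? T | (c , suc i) ∈? T
... | yes _ | yes _ = refl
... | yes _ | no _  = refl
... | no _  | no _  = refl
... | no _  | yes _ with l
...   | []    = refl
...   | _ ∷ _ = refl

scan : (ℕ → Occupancy) → ℕ → PairState
scan g zero    = [] , []
scan g (suc m) = step (g m) (scan g m) m

foldl-scan : ∀ i T m → foldl (pairStep i T) ([] , []) (upTo m) ≡ scan (occ i T) m
foldl-scan i T zero    = refl
foldl-scan i T (suc m) = begin
  foldl (pairStep i T) ([] , []) (upTo (suc m))
    ≡⟨ cong (foldl (pairStep i T) ([] , [])) (sym (upTo-∷ʳ m)) ⟩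
  foldl (pairStep i T) ([] , []) (upTo m ∷ʳ m)
    ≡⟨ foldl-∷ʳ (pairStep i T) ([] , []) m (upTo m) ⟩
  pairStep i T (foldl (pairStep i T) ([] , []) (upTo m)) m
    ≡⟨ pairStep-step i T _ m ⟩
  step (occ i T m) (foldl (pairStep i T) ([] , []) (upTo m)) m
    ≡⟨ cong (λ s → step (occ i T m) s m) (foldl-scan i T m) ⟩
  scan (occ i T) (suc m) ∎
  where open ≡-Reasoning

scan-agree : ∀ {g g'} m → (∀ y → y < m → g y ≡ g' y) → scan g m ≡ scan g' m
scan-agree zero    _     = refl
scan-agree (suc m) agree =
  cong₂ (λ t s → step t s m) (agree m (n<1+n m))
        (scan-agree m (λ y y<m → agree y (m<n⇒m<1+n y<m)))

scan-vacant : ∀ {g k} → (∀ y → k ≤ y → g y ≡ (false , false)) →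
              ∀ m → k ≤ m → scan g m ≡ scan g k
scan-vacant vacant zero    z≤n = refl
scan-vacant {g} {k} vacant (suc m) k≤1+m with m≤n⇒m<n∨m≡n k≤1+m
... | inj₂ refl       = refl
... | inj₁ (s≤s k≤m) =
  trans (cong (λ t → step t (scan g m) m) (vacant m k≤m)) (scan-vacant vacant m k≤m)

-- Beyond maxCol A every column of A is empty, so the pairing of A is its scan
-- over any number of columns exceeding maxCol A.
column≤maxCol : ∀ {c r} A → (c , r) ∈ A → c ≤ maxCol A
column≤maxCol (x ∷ A) (here refl) = m≤m⊔n _ _
column≤maxCol (x ∷ A) (there p)   = ≤-trans (column≤maxCol A p) (m≤n⊔m (proj₁ x) _)

occ-beyond : ∀ i A y → maxCol A < y → occ i A y ≡ (false , false)
occ-beyond i A y maxCol<y = cong₂ _,_ (absent ((y , i) ∈? A)) (absent ((y , suc i) ∈? A))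
  where
  absent : ∀ {r} (d : Dec ((y , r) ∈ A)) → does d ≡ false
  absent (yes p) = contradiction (<-≤-trans maxCol<y (column≤maxCol A p)) (<-irrefl refl)
  absent (no _)  = refl

pairing-scan : ∀ i A n → maxCol A < n → pairing i A ≡ scan (occ i A) n
pairing-scan i A n maxCol<n =
  trans (foldl-scan i A (suc (maxCol A)))
        (sym (scan-vacant (occ-beyond i A) n maxCol<n))

occ-≈ : ∀ i {A B} → A ≈ B → ∀ y → occ i A y ≡ occ i B y
occ-≈ i {A} {B} A≈B y = cong₂ _,_ (same (y , i)) (same (y , suc i))
  where
  same : ∀ x → does (x ∈? A) ≡ does (x ∈? B)
  same x = does-⇔ (A≈B x) (x ∈? A) (x ∈? B)

pairing-≈ : ∀ i {A B} → A ≈ B → pairing i A ≡ pairing i B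
pairing-≈ i {A} {B} A≈B = begin
  pairing i A            ≡⟨ pairing-scan i A n (s≤s (m≤m⊔n _ _)) ⟩
  scan (occ i A) n       ≡⟨ scan-agree n (λ y _ → occ-≈ i A≈B y) ⟩
  scan (occ i B) n       ≡⟨ sym (pairing-scan i B n (s≤s (m≤n⊔m _ _))) ⟩
  pairing i B            ∎
  where
  open ≡-Reasoning
  n = suc (maxCol A ⊔ maxCol B)

Below : ℕ → PairState → Set
Below m (l , u) = All (_< m) l × All (_< m) u

weaken : ∀ {m xs} → All (_< m) xs → All (_< suc m) xs
weaken = All.map m<n⇒m<1+n

step-below : ∀ t s m → Below m s → Below (suc m) (step t s m)
step-below (true  , true ) s           m (bl , bu)     = weaken bl , weaken bu
step-below (true  , false) s           m (bl , bu)     = n<1+n m ∷ weaken bl , weaken bu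
step-below (false , false) s           m (bl , bu)     = weaken bl , weaken bu
step-below (false , true ) ([] , u)    m (bl , bu)     = [] , n<1+n m ∷ weaken bu
step-below (false , true ) (_ ∷ l , u) m (_ ∷ bl , bu) = weaken bl , weaken bu

scan-below : ∀ g m → Below m (scan g m)
scan-below g zero    = [] , []
scan-below g (suc m) = step-below (g m) (scan g m) m (scan-below g m)

∉-scan : ∀ g c → c ∉ₗ proj₁ (scan g c) × c ∉ₗ proj₂ (scan g c)
∉-scan g c = fresh (proj₁ (scan-below g c)) , fresh (proj₂ (scan-below g c))
  where
  fresh : ∀ {xs} → All (_< c) xs → c ∉ₗ xs
  fresh below c∈xs = <-irrefl refl (All.lookup below c∈xs)

not-headed : ∀ {c : ℕ} {w u} → c ∉ₗ u → u ≢ c ∷ w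
not-headed c∉u refl = c∉u (here refl)

not-ending : ∀ {c : ℕ} {b l} → c ∉ₗ l → l ≢ b ∷ʳ c
not-ending {c} {b} c∉l refl = c∉l (∈-∷ʳ b c)

raise-first : ∀ {c w} t s → c ∉ₗ proj₂ s → proj₂ (step t s c) ≡ c ∷ w →
              t ≡ (false , true) × proj₁ s ≡ [] × proj₂ s ≡ w × proj₁ (step t s c) ≡ []
raise-first (true  , true ) s           c∉u e = contradiction e (not-headed c∉u)
raise-first (true  , false) s           c∉u e = contradiction e (not-headed c∉u)
raise-first (false , false) s           c∉u e = contradiction e (not-headed c∉u)
raise-first (false , true ) ([] , u)    c∉u e = refl , refl , proj₂ (∷-injective e) , refl
raise-first (false , true ) (_ ∷ _ , u) c∉u e = contradiction e (not-headed c∉u)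

raise-later : ∀ {c w} t a v m → m ≢ c → proj₂ (step t (a , v) m) ≡ c ∷ w →
              v ≡ c ∷ w × step t (a ∷ʳ c , w) m ≡ (proj₁ (step t (a , v) m) ∷ʳ c , w)
raise-later (true  , true ) a       v m m≢c e = e , refl
raise-later (true  , false) a       v m m≢c e = e , refl
raise-later (false , false) a       v m m≢c e = e , refl
raise-later (false , true ) []      v m m≢c e = contradiction (proj₁ (∷-injective e)) m≢c
raise-later (false , true ) (_ ∷ a) v m m≢c e = e , refl

lower-first : ∀ {c b} t s → c ∉ₗ proj₁ s → proj₁ (step t s c) ≡ b ∷ʳ c →
              t ≡ (true , false) × proj₁ s ≡ [] × b ≡ []
lower-first (true  , true ) s        c∉l e = contradiction e (not-ending c∉l)
lower-first {c} {[]}     (true  , false) (l , u)  c∉l e = refl , proj₂ (∷-injective e) , refl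
lower-first {c} {y ∷ b'} (true  , false) (l , u)  c∉l e = contradiction (proj₂ (∷-injective e)) (not-ending c∉l)
lower-first (false , false) s        c∉l e = contradiction e (not-ending c∉l)
lower-first {c} {[]}    (false , true ) ([] , u) c∉l ()
lower-first {c} {_ ∷ _} (false , true ) ([] , u) c∉l ()
lower-first (false , true ) (x ∷ l , u) c∉l e = contradiction e (not-ending (λ c∈l → c∉l (there c∈l)))

lower-later : ∀ {c b} t a v m → m ≢ c → proj₁ (step t (a , v) m) ≡ b ∷ʳ c →
              Σ[ a' ∈ List ℕ ] (a ≡ a' ∷ʳ c × proj₂ (step t (a , v) m) ≡ v ×
                                (∀ w → step t (a' , c ∷ w) m ≡ (b , c ∷ w)))
lower-later {b = b} (true  , true ) a v m m≢c e = b , e , refl , λ _ → refl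
lower-later {b = []}     (true  , false) a v m m≢c e = contradiction (proj₁ (∷-injective e)) m≢c
lower-later {b = y ∷ b'} (true  , false) a v m m≢c e with ∷-injective e
... | refl , a≡ = b' , a≡ , refl , λ _ → refl
lower-later {b = b} (false , false) a v m m≢c e = b , e , refl , λ _ → refl
lower-later {b = []}    (false , true ) [] v m m≢c ()
lower-later {b = _ ∷ _} (false , true ) [] v m m≢c ()
lower-later {c} {b} (false , true ) (x ∷ a) v m m≢c e = x ∷ b , cong (x ∷_) e , refl , λ _ → refl

module Swap {g g' : ℕ → Occupancy} {c : ℕ} (agree : ∀ y → y ≢ c → g y ≡ g' y) where

  agree-before : scan g c ≡ scan g' c
  agree-before = scan-agree c (λ y y<c → agree y (<⇒≢ y<c))

  -- After scanning m columns: if c is the newest unpaired upper column for g,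
  -- then g' (where that cell has moved down) has c at the bottom of its stack.
  RaisedAt : ℕ → Set
  RaisedAt m = ∀ {w} → proj₂ (scan g m) ≡ c ∷ w →
               g c ≡ (false , true) × scan g' m ≡ (proj₁ (scan g m) ∷ʳ c , w)

  raised-start : g' c ≡ (true , false) → RaisedAt (suc c)
  raised-start g'c {w} e with raise-first (g c) (scan g c) (proj₂ (∉-scan g c)) e
  ... | gc , l≡[] , u≡w , l'≡[] = gc , (begin
    step (g' c) (scan g' c) c
      ≡⟨ cong₂ (λ t s → step t s c) g'c (sym agree-before) ⟩
    (c ∷ proj₁ (scan g c) , proj₂ (scan g c))
      ≡⟨ cong₂ (λ l u → c ∷ l , u) l≡[] u≡w ⟩
    ([] ∷ʳ c , w)
      ≡⟨ cong (λ l → l ∷ʳ c , w) (sym l'≡[]) ⟩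
    (proj₁ (scan g (suc c)) ∷ʳ c , w) ∎)
    where open ≡-Reasoning

  raised-continue : ∀ m → m ≢ c → RaisedAt m → RaisedAt (suc m)
  raised-continue m m≢c raisedAt {w} e
    with raise-later (g m) (proj₁ (scan g m)) (proj₂ (scan g m)) m m≢c e
  ... | u≡ , stepped = proj₁ (raisedAt u≡) , (begin
    step (g' m) (scan g' m) m
      ≡⟨ cong₂ (λ t s → step t s m) (sym (agree m m≢c)) (proj₂ (raisedAt u≡)) ⟩
    step (g m) (proj₁ (scan g m) ∷ʳ c , w) m
      ≡⟨ stepped ⟩
    (proj₁ (scan g (suc m)) ∷ʳ c , w) ∎)
    where open ≡-Reasoning

  raised : g' c ≡ (true , false) → ∀ m → c < m → RaisedAt m
  raised g'c (suc m) (s≤s c≤m) with m≤n⇒m<n∨m≡n c≤m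
  ... | inj₂ refl = raised-start g'c
  ... | inj₁ c<m  = raised-continue m (λ m≡c → <⇒≢ c<m (sym m≡c)) (raised g'c m c<m)

  -- After scanning m columns: if c is at the bottom of g's stack (the oldest
  -- unpaired lower column), then g' (where that cell has moved up) has c as
  -- its newest unpaired upper column.
  LoweredAt : ℕ → Set
  LoweredAt m = ∀ {b} → proj₁ (scan g m) ≡ b ∷ʳ c →
                g c ≡ (true , false) × scan g' m ≡ (b , c ∷ proj₂ (scan g m))

  lowered-start : g' c ≡ (false , true) → LoweredAt (suc c)
  lowered-start g'c {b} e with lower-first (g c) (scan g c) (proj₁ (∉-scan g c)) e
  ... | gc , l≡[] , b≡[] = gc , (begin
    step (g' c) (scan g' c) c
      ≡⟨ cong₂ (λ t s → step t s c) g'c (sym agree-before) ⟩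
    step (false , true) (proj₁ (scan g c) , proj₂ (scan g c)) c
      ≡⟨ cong (λ l → step (false , true) (l , proj₂ (scan g c)) c) l≡[] ⟩
    ([] , c ∷ proj₂ (scan g c))
      ≡⟨ cong₂ (λ b' u → b' , c ∷ u) (sym b≡[]) (cong (λ t → proj₂ (step t (scan g c) c)) (sym gc)) ⟩
    (b , c ∷ proj₂ (scan g (suc c))) ∎)
    where open ≡-Reasoning

  lowered-continue : ∀ m → m ≢ c → LoweredAt m → LoweredAt (suc m)
  lowered-continue m m≢c loweredAt {b} e
    with lower-later (g m) (proj₁ (scan g m)) (proj₂ (scan g m)) m m≢c e
  ... | a' , a≡ , kept , stepped = proj₁ (loweredAt a≡) , (begin
    step (g' m) (scan g' m) m
      ≡⟨ cong₂ (λ t s → step t s m) (sym (agree m m≢c)) (proj₂ (loweredAt a≡)) ⟩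
    step (g m) (a' , c ∷ proj₂ (scan g m)) m
      ≡⟨ stepped (proj₂ (scan g m)) ⟩
    (b , c ∷ proj₂ (scan g m))
      ≡⟨ cong (λ u → b , c ∷ u) (sym kept) ⟩
    (b , c ∷ proj₂ (scan g (suc m))) ∎)
    where open ≡-Reasoning

  lowered : g' c ≡ (false , true) → ∀ m → c < m → LoweredAt m
  lowered g'c (suc m) (s≤s c≤m) with m≤n⇒m<n∨m≡n c≤m
  ... | inj₂ refl = lowered-start g'c
  ... | inj₁ c<m  = lowered-continue m (λ m≡c → <⇒≢ c<m (sym m≡c)) (lowered g'c m c<m)

∈-move⁻ : ∀ {x f t A} → x ∈ move f t A → x ≡ t ⊎ (x ∈ A × x ≢ f)
∈-move⁻ (here x≡t) = inj₁ x≡t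
∈-move⁻ (there x∈) = inj₂ (∈-filter⁻ (λ y → ¬? (y ≟c _)) x∈)

∈-move⁺ : ∀ {x f t A} → x ∈ A → x ≢ f → x ∈ move f t A
∈-move⁺ x∈A x≢f = there (∈-filter⁺ (λ y → ¬? (y ≟c _)) x∈A x≢f)

moved-away : ∀ {f t A} → f ≢ t → f ∉ move f t A
moved-away {f} {t} {A} f≢t f∈ with ∈-move⁻ {f} {f} {t} {A} f∈
... | inj₁ f≡t         = f≢t f≡t
... | inj₂ (_ , f≢f)   = f≢f refl

∈-move⇔ : ∀ {x f t A} → x ≢ f → x ≢ t → x ∈ move f t A ⇔ x ∈ A
∈-move⇔ {x} {f} {t} {A} x≢f x≢t = mk⇔ from-move (λ x∈A → ∈-move⁺ {x} {f} {t} {A} x∈A x≢f)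
  where
  from-move : x ∈ move f t A → x ∈ A
  from-move x∈ with ∈-move⁻ {x} {f} {t} {A} x∈
  ... | inj₁ x≡t       = contradiction x≡t x≢t
  ... | inj₂ (x∈A , _) = x∈A

column-≢ : ∀ {y c r r' : ℕ} → y ≢ c → (y , r) ≢ (c , r')
column-≢ y≢c eq = y≢c (cong proj₁ eq)

row-≢ : ∀ {c i : ℕ} → (c , suc i) ≢ (c , i)
row-≢ eq = 1+n≢n (cong proj₂ eq)

occ-move-other : ∀ i c r r' A y → y ≢ c → occ i (move (c , r) (c , r') A) y ≡ occ i A y
occ-move-other i c r r' A y y≢c = cong₂ _,_ (same i) (same (suc i))
  where
  same : ∀ k → does ((y , k) ∈? move (c , r) (c , r') A) ≡ does ((y , k) ∈? A)
  same k = does-⇔ (∈-move⇔ {A = A} (column-≢ y≢c) (column-≢ y≢c)) (_ ∈? _) ((y , k) ∈? A)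

occ-lowered : ∀ i c T → occ i (move (c , suc i) (c , i) T) c ≡ (true , false)
occ-lowered i c T =
  cong₂ _,_ (dec-true ((c , i) ∈? move (c , suc i) (c , i) T) (here refl))
            (dec-false ((c , suc i) ∈? _) (moved-away {A = T} row-≢))

occ-raised : ∀ i c S → occ i (move (c , i) (c , suc i) S) c ≡ (false , true)
occ-raised i c S =
  cong₂ _,_ (dec-false ((c , i) ∈? _) (moved-away {A = S} (λ eq → row-≢ (sym eq))))
            (dec-true ((c , suc i) ∈? move (c , i) (c , suc i) S) (here refl))

does-true : ∀ {P : Set} (d : Dec P) → does d ≡ true → P
does-true (yes p) _ = p

does-false : ∀ {P : Set} (d : Dec P) → does d ≡ false → ¬ P
does-false (no ¬p) _ = ¬p

upper-only : ∀ i A c → occ i A c ≡ (false , true) → (c , i) ∉ A × (c , suc i) ∈ A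
upper-only i A c eq = does-false (_ ∈? A) (cong proj₁ eq) , does-true (_ ∈? A) (cong proj₂ eq)

lower-only : ∀ i A c → occ i A c ≡ (true , false) → (c , i) ∈ A × (c , suc i) ∉ A
lower-only i A c eq = does-true (_ ∈? A) (cong proj₁ eq) , does-false (_ ∈? A) (cong proj₂ eq)

module ⇔ = IsEquivalence (⇔-isEquivalence {ℓ = Level.zero})

≈-sym : ∀ {A B} → A ≈ B → B ≈ A
≈-sym A≈B x = ⇔.sym (A≈B x)

≈-trans : ∀ {A B C} → A ≈ B → B ≈ C → A ≈ C
≈-trans A≈B B≈C x = ⇔.trans (A≈B x) (B≈C x)

move-≈ : ∀ {f t A B} → A ≈ B → move f t A ≈ move f t B
move-≈ {f} {t} A≈B x = mk⇔ (transport A≈B) (transport (≈-sym A≈B))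
  where
  transport : ∀ {A B} → A ≈ B → x ∈ move f t A → x ∈ move f t B
  transport {A} {B} A≈B x∈ with ∈-move⁻ {x} {f} {t} {A} x∈
  ... | inj₁ refl        = here refl
  ... | inj₂ (x∈A , x≢f) = ∈-move⁺ {x} {f} {t} {B} (Equivalence.to (A≈B x) x∈A) x≢f

move-back : ∀ {p q A} → p ∈ A → q ∉ A → p ≢ q → move q p (move p q A) ≈ A
move-back {p} {q} {A} p∈A q∉A p≢q x = mk⇔ to from
  where
  to : x ∈ move q p (move p q A) → x ∈ A
  to x∈ with ∈-move⁻ {x} {q} {p} {move p q A} x∈
  ... | inj₁ refl       = p∈A
  ... | inj₂ (x∈ , x≢q) with ∈-move⁻ {x} {p} {q} {A} x∈
  ...   | inj₁ x≡q       = contradiction x≡q x≢q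
  ...   | inj₂ (x∈A , _) = x∈A
  from : x ∈ A → x ∈ move q p (move p q A)
  from x∈A with x ≟c p
  ... | yes refl = here refl
  ... | no x≢p   = ∈-move⁺ {x} {q} {p} {move p q A} (∈-move⁺ {x} {p} {q} {A} x∈A x≢p)
                           (λ { refl → q∉A x∈A })

KD-≈ : ∀ {D A B} → KD D A → A ≈ B → KD D B
KD-≈ (kd-base A≈D) A≈B = kd-base (≈-trans (≈-sym A≈B) A≈D)
KD-≈ (kd-step kd (c , r , r' , c∈ , rightmost , 1≤r' , r'<r , free , jumped , A≈))
     A≈B = kd-step kd (c , r , r' , c∈ , rightmost , 1≤r' , r'<r , free , jumped , ≈-trans (≈-sym A≈B) A≈)

raise-inv : ∀ i T {S'} → raise i T ≡ just S' →
            Σ[ c ∈ ℕ ] Σ[ w ∈ List ℕ ] (unpairedUpper i T ≡ c ∷ w × move (c , suc i) (c , i) T ≡ S')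
raise-inv i T eq with unpairedUpper i T
... | c ∷ w = c , w , refl , just-injective eq

lower-inv : ∀ i S {T'} → lowerCandidate i S ≡ just T' →
            Σ[ c ∈ ℕ ] (last (unpairedLower i S) ≡ just c × move (c , i) (c , suc i) S ≡ T')
lower-inv i S eq with last (unpairedLower i S)
... | just c = c , refl , just-injective eq

raise-of : ∀ i T {c w} → unpairedUpper i T ≡ c ∷ w → raise i T ≡ just (move (c , suc i) (c , i) T)
raise-of i T upper rewrite upper = refl

lower-of : ∀ i S {c} → last (unpairedLower i S) ≡ just c →
           lowerCandidate i S ≡ just (move (c , i) (c , suc i) S)
lower-of i S leftmost rewrite leftmost = refl

raise-then-lower : ∀ i T {c w} → unpairedUpper i T ≡ c ∷ w →
                   (c , i) ∉ T × (c , suc i) ∈ T ×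
                   last (unpairedLower i (move (c , suc i) (c , i) T)) ≡ just c
raise-then-lower i T {c} {w} upper =
  upper-only i T c upper-only-c .proj₁ , upper-only i T c upper-only-c .proj₂ , (begin
    last (proj₁ (pairing i M))            ≡⟨ cong (λ s → last (proj₁ s)) (pairing-scan i M n M<n) ⟩
    last (proj₁ (scan (occ i M) n))       ≡⟨ cong (λ s → last (proj₁ s)) scanM ⟩
    last (proj₁ (scan (occ i T) n) ∷ʳ c)  ≡⟨ last-∷ʳ (proj₁ (scan (occ i T) n)) c ⟩
    just c                                ∎)
  where
  open ≡-Reasoning
  M = move (c , suc i) (c , i) T
  n = suc (maxCol T ⊔ maxCol M)
  T<n : maxCol T < n
  T<n = s≤s (m≤m⊔n (maxCol T) (maxCol M))
  M<n : maxCol M < n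
  M<n = s≤s (m≤n⊔m (maxCol T) (maxCol M))
  open Swap {occ i T} {occ i M} {c} (λ y y≢c → sym (occ-move-other i c (suc i) i T y y≢c))
  upperT : proj₂ (scan (occ i T) n) ≡ c ∷ w
  upperT = trans (cong proj₂ (sym (pairing-scan i T n T<n))) upper
  c<n : c < n
  c<n = All.head (subst (All (_< n)) upperT (proj₂ (scan-below (occ i T) n)))
  upper-only-c : occ i T c ≡ (false , true)
  upper-only-c = proj₁ (raised (occ-lowered i c T) n c<n upperT)
  scanM : scan (occ i M) n ≡ (proj₁ (scan (occ i T) n) ∷ʳ c , w)
  scanM = proj₂ (raised (occ-lowered i c T) n c<n upperT)

lower-then-raise : ∀ i S {c} → last (unpairedLower i S) ≡ just c →
                   (c , i) ∈ S × (c , suc i) ∉ S ×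
                   Σ[ w ∈ List ℕ ] (unpairedUpper i (move (c , i) (c , suc i) S) ≡ c ∷ w)
lower-then-raise i S {c} leftmost =
  lower-only i S c lower-only-c .proj₁ , lower-only i S c lower-only-c .proj₂ , proj₂ (scan (occ i S) n) ,
  trans (cong proj₂ (pairing-scan i N n N<n)) (cong proj₂ scanN)
  where
  N = move (c , i) (c , suc i) S
  n = suc (maxCol S ⊔ maxCol N)
  S<n : maxCol S < n
  S<n = s≤s (m≤m⊔n (maxCol S) (maxCol N))
  N<n : maxCol N < n
  N<n = s≤s (m≤n⊔m (maxCol S) (maxCol N))
  open Swap {occ i S} {occ i N} {c} (λ y y≢c → sym (occ-move-other i c i (suc i) S y y≢c))
  stack : Σ[ b ∈ List ℕ ] (proj₁ (scan (occ i S) n) ≡ b ∷ʳ c)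
  stack = last-just (proj₁ (scan (occ i S) n))
                    (trans (cong (λ s → last (proj₁ s)) (sym (pairing-scan i S n S<n))) leftmost)
  c<n : c < n
  c<n = All.lookup (subst (All (_< n)) (proj₂ stack) (proj₁ (scan-below (occ i S) n)))
                   (∈-∷ʳ (proj₁ stack) c)
  lower-only-c : occ i S c ≡ (true , false)
  lower-only-c = proj₁ (lowered (occ-raised i c S) n c<n (proj₂ stack))
  scanN : scan (occ i N) n ≡ (proj₁ stack , c ∷ proj₂ (scan (occ i S) n))
  scanN = proj₂ (lowered (occ-raised i c S) n c<n (proj₂ stack))

raise⇒lower : ∀ D i {S T} → KD D T → RaiseEq i T S → LowerEq D i S T
raise⇒lower D i {S} {T} kdT (S' , raised , S'≈S) with raise-inv i T raised
... | c , w , upper , refl with raise-then-lower i T upper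
...   | c,i∉T , c,i+1∈T , leftmostM =
  move (c , i) (c , suc i) S , lower-of i S leftmostS , KD-≈ kdT (≈-sym T'≈T) , T'≈T
  where
  S≈M = ≈-sym S'≈S
  leftmostS : last (unpairedLower i S) ≡ just c
  leftmostS = trans (cong (λ s → last (proj₁ s)) (pairing-≈ i S≈M)) leftmostM
  T'≈T : move (c , i) (c , suc i) S ≈ T
  T'≈T = ≈-trans (move-≈ S≈M) (move-back c,i+1∈T c,i∉T row-≢)

lower⇒raise : ∀ D i {S T} → LowerEq D i S T → RaiseEq i T S
lower⇒raise D i {S} {T} (T' , lowered , _ , T'≈T) with lower-inv i S lowered
... | c , leftmost , refl with lower-then-raise i S leftmost
...   | c,i∈S , c,i+1∉S , w , rightmostN =
  move (c , suc i) (c , i) T , raise-of i T rightmostT , S'≈S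
  where
  T≈N = ≈-sym T'≈T
  rightmostT : unpairedUpper i T ≡ c ∷ w
  rightmostT = trans (cong proj₂ (pairing-≈ i T≈N)) rightmostN
  S'≈S : move (c , suc i) (c , i) T ≈ S
  S'≈S = ≈-trans (move-≈ T≈N) (move-back c,i∈S c,i+1∉S (λ eq → row-≢ (sym eq)))

proposition4p5 : (D : Diagram) → ValidDiagram D → Southwest D →
                 (i : ℕ) → 1 ≤ i → (S T : Diagram) → KD D S → KD D T →
                 (RaiseEq i T S ⇔ LowerEq D i S T)
proposition4p5 D _ _ i _ S T _ kdT = mk⇔ (raise⇒lower D i kdT) (lower⇒raise D i)
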